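{- For every integer $n \geq 0$ and every integer $i \geq 1$, \[ \sum_{j=i}^{\infty} b_j(n) \equiv 0 \pmod{i}, \] where the sum is finite because only finitely many $b_j(n)$ are nonzero.
   Context: Tchoukaillon boards. For each $n \geq 0$ define a sequence $b(n) = (b_1(n), b_2(n), \ldots)$ of nonnegative integers recursively: $b(0)$ is the all-zero sequence; given $b(n)$, let $p(n) = \min\{j \geq 1 : b_j(n) = 0\}$ and set $b_i(n+1) = b_i(n)$ if $i > p(n)$, $b_i(n+1) = i$ if $i = p(n)$, and $b_i(n+1) = b_i(n) - 1$ if $i < p(n)$. Here $b_i(n)$ is the number of stones in bin $i$ (bin $1$ being adjacent to the store) of the unique winning Tchoukaillon board with $n$ stones in total; in particular $\sum_{j \geq 1} b_j(n) = n$. -}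

module Defs where

open import Data.Nat using (ℕ; zero; suc; _∸_)
open import Data.List using (List; []; _∷_; drop)
open import Data.Nat.ListAction using (sum)

-- A board is a finite-support sequence b_1, b_2, ... of naturals, represented
-- by the list [b_1, ..., b_m]; all bins beyond position m hold 0.

-- One sowing step (b(n) ↦ b(n+1)).  `go i bs` processes bins starting at bin i:
-- while b_i ≠ 0 we decrement it; at the first bin p with b_p = 0 (possibly
-- beyond the end of the list, where bins are implicitly 0) we put p stones,
-- and leave all later bins unchanged.
stepFrom : ℕ → List ℕ → List ℕ
stepFrom i []           = i ∷ []
stepFrom i (zero  ∷ bs) = i ∷ bs
stepFrom i (suc x ∷ bs) = x ∷ stepFrom (suc i) bs

step : List ℕ → List ℕ
step = stepFrom 1

board : ℕ → List ℕ
board zero    = []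
board (suc n) = step (board n)

-- b_i(n) for i ≥ 1 (bin i is the (i-1)-th list entry; 0 beyond the list)
bin : ℕ → ℕ → ℕ
bin n i = go (i ∸ 1) (board n)
  where
  go : ℕ → List ℕ → ℕ
  go _       []       = 0
  go zero    (x ∷ _)  = x
  go (suc k) (_ ∷ xs) = go k xs

tailSum : ℕ → ℕ → ℕ
tailSum n i = sum (drop (i ∸ 1) (board n))

module Submission where

-- Call a board `balanced from k` when, for every d, the stones in
-- the bins from position d onward (positions counted from k) number a multiple
-- of k + d; board(n) being balanced from 1 is exactly the corollary.  The empty
-- board is balanced, and one sowing step preserves balance: looking at the
-- bins from position d onward, either the sowing stopped before position d (so
-- that suffix is unchanged), or the suffix itself is sown from bin k + d, which
-- adds exactly k + d stones to it.

open import Defs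
open import Data.Nat using (ℕ; _≤_; zero; suc; _+_)
open import Data.Nat.Divisibility using (_∣_; ∣m∣n⇒∣m+n; ∣-refl; _∣0)
open import Data.Nat.Properties using (+-suc; +-assoc; +-comm; +-identityʳ)
open import Data.List using (List; []; _∷_; drop)
open import Data.Nat.ListAction using (sum)
open import Data.Sum using (_⊎_; inj₁; inj₂)
open import Relation.Binary.PropositionalEquality
open ≡-Reasoning

-- Sowing from bin k adds exactly k stones: bins k, ..., p - 1 each lose one
-- stone and the first empty bin p receives p, a net gain of p - (p - k) = k.
sum-stepFrom : ∀ k bs → sum (stepFrom k bs) ≡ sum bs + k
sum-stepFrom k []           = +-comm k 0
sum-stepFrom k (zero  ∷ bs) = +-comm k (sum bs)
sum-stepFrom k (suc x ∷ bs) = begin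
  x + sum (stepFrom (suc k) bs)  ≡⟨ cong (x +_) (sum-stepFrom (suc k) bs) ⟩
  x + (sum bs + suc k)           ≡⟨ +-assoc x (sum bs) (suc k) ⟨
  x + sum bs + suc k             ≡⟨ +-suc (x + sum bs) k ⟩
  suc (x + sum bs + k)           ∎

drop-stepFrom : ∀ k bs d → drop d (stepFrom k bs) ≡ drop d bs
                         ⊎ drop d (stepFrom k bs) ≡ stepFrom (k + d) (drop d bs)
drop-stepFrom k bs           zero          = inj₂ (cong (λ m → stepFrom m bs) (sym (+-identityʳ k)))
drop-stepFrom k []           (suc zero)    = inj₁ refl
drop-stepFrom k []           (suc (suc d)) = inj₁ refl
drop-stepFrom k (zero  ∷ bs) (suc d)       = inj₁ refl
drop-stepFrom k (suc x ∷ bs) (suc d) with drop-stepFrom (suc k) bs d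
... | inj₁ unchanged = inj₁ unchanged
... | inj₂ sown      = inj₂ (trans sown (cong (λ m → stepFrom m (drop d bs)) (sym (+-suc k d))))

Balanced : ℕ → List ℕ → Set
Balanced k bs = ∀ d → k + d ∣ sum (drop d bs)

[]-balanced : ∀ k → Balanced k []
[]-balanced k zero    = (k + 0) ∣0
[]-balanced k (suc d) = (k + suc d) ∣0

stepFrom-balanced : ∀ k bs → Balanced k bs → Balanced k (stepFrom k bs)
stepFrom-balanced k bs balanced d with drop-stepFrom k bs d
... | inj₁ unchanged = subst (λ s → k + d ∣ sum s) (sym unchanged) (balanced d)
... | inj₂ sown      = subst (λ s → k + d ∣ sum s) (sym sown) sownSuffix
  where
  -- The sown suffix gains exactly k + d stones.
  sownSuffix : k + d ∣ sum (stepFrom (k + d) (drop d bs))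
  sownSuffix = subst (k + d ∣_) (sym (sum-stepFrom (k + d) (drop d bs)))
                     (∣m∣n⇒∣m+n (balanced d) ∣-refl)

board-balanced : ∀ n → Balanced 1 (board n)
board-balanced zero    = []-balanced 1
board-balanced (suc n) = stepFrom-balanced 1 (board n) (board-balanced n)

corollary3p1 : (n i : ℕ) → 1 ≤ i → i ∣ tailSum n i
corollary3p1 n (suc d) _ = board-balanced n d
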